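{- Let $\mathcal M_{\mathcal I}$ be a system and $\mathcal S$ a finite set of indefinitely large relations on it. Then $\ll_{\mathcal S}$ is an indefinitely large $\ll$-relation.
   Context: $\mathcal I$: non-empty set with directed preorder $\le$; $\uparrow i=\{i'\ge i\}$. Contexts $C\in\mathcal I^n$, $()$ empty, $Ci$ extension. $\mathfrak D_n\subseteq\mathcal P(\mathcal I^n)$: $\mathcal H\in\mathfrak D_0$ iff $\mathcal H=\{()\}$; $\mathcal H\in\mathfrak D_1$ iff $\uparrow i\subseteq\mathcal H$ for some $i$; for $\mathcal H\subseteq\mathcal I^{n+1}$, $\mathcal H\in\mathfrak D_{n+1}$ iff $\{C\in\mathcal I^n:\{i:Ci\in\mathcal H\}\in\mathfrak D_1\}\in\mathfrak D_n$. System $\mathcal M_{\mathcal I}=(\mathcal M_i)_{i\in\mathcal I}$: finite sets, $\mathcal M_i\subseteq\mathcal M_{i'}$ for $i\le i'$, at least one non-empty; $\mathcal M_C=\mathcal M_{i_0}\times\dots\times\mathcal M_{i_{n-1}}$. A $k$-ary relation on it: compatible family $(R_C)_{C\in\mathcal H}$, $\emptyset\ne\mathcal H\subseteq\mathcal I^{k}$, $R_C\subseteq\mathcal M_C$ ($R_C(\vec a)\iff R_{C'}(\vec a)$ on $\mathcal M_C\cap\mathcal M_{C'}$); indefinitely large iff $\mathcal H\in\mathfrak D_k$. For an $(n+1)$-ary relation $R_{\mathcal H}$, $C\in\mathcal I^n$, $\vec a\in\mathcal M_C$: $\mathcal I_{R,\vec a:C}=\{i: Ci\in\mathcal H,\ \exists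 b\in\mathcal M_i\, R_{Ci}(\vec ab)\}$ if non-empty, else $\mathcal I$. $(\ll_R)_{n+1}=\{Ci: i\in\bigcap_{\vec a\in\mathcal M_C}\mathcal I_{R,\vec a:C}\}$, and $\ll_R$ is the family generated by it: for $m<n+1$, $(\ll_R)_m$ is the set of prefixes of length $m$ of elements of $(\ll_R)_{n+1}$; for $m>n+1$, $(\ll_R)_m=(\ll_R)_{n+1}\times\mathcal I^{m-n-1}$. For a set $\mathcal S$ of relations, $\ll_{\mathcal S}$ is given by $(\ll_{\mathcal S})_m=\bigcap_{R\in\mathcal S}(\ll_R)_m$ for each $m$. A $\ll$-relation is a family $(\ll_m)_m$, $\ll_m\subseteq\mathcal I^m$, with $Ci\in\ll_{m+1}\Rightarrow C\in\ll_m$; indefinitely large iff $\ll_m\in\mathfrak D_m$ for all $m$. -}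

module Defs where

open import Level using (0ℓ; Level)
open import Data.Nat using (ℕ; zero; suc; _≤_; _<_)
open import Data.Vec using (Vec; []; _∷_; _∷ʳ_)
open import Data.List using (List)
open import Data.List.Membership.Propositional using (_∈_)
open import Data.List.Relation.Unary.All using (All)
open import Data.Product using (Σ; ∃; ∃-syntax; _×_; _,_; proj₁; proj₂)
open import Data.Sum using (_⊎_)
open import Data.Unit using (⊤)
open import Data.Empty using (⊥)
open import Relation.Nullary using (¬_)
open import Relation.Binary.PropositionalEquality using (_≡_)

-- The finite sets M_i are represented as lists over a common carrier A
-- (membership = list membership), so that "M_i ⊆ M_i'" and intersections
-- M_C ∩ M_C' make sense.
record System : Set₁ where
  field
    I         : Set
    _≼_       : I → I → Set
    ≼-refl    : ∀ {i} → i ≼ i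
    ≼-trans   : ∀ {i j k} → i ≼ j → j ≼ k → i ≼ k
    directed  : ∀ i j → ∃[ k ] (i ≼ k × j ≼ k)
    inhabited : I
    A         : Set
    M         : I → List A
    mono      : ∀ {i i'} → i ≼ i' → ∀ {a} → a ∈ M i → a ∈ M i'
    nonempty  : ∃[ i ] ∃[ a ] (a ∈ M i)

module _ (Sys : System) where
  open System Sys

  -- Contexts are Vec I n; the extension Ci is C ∷ʳ i.
  -- Subsets of I^n are predicates on Vec I n.

  D1 : ∀ {ℓ} → (I → Set ℓ) → Set ℓ
  D1 P = ∃[ i ] (∀ i' → i ≼ i' → P i')

  𝔇 : ∀ {ℓ} (n : ℕ) → (Vec I n → Set ℓ) → Set ℓ
  𝔇 zero    ℋ = ℋ []
  𝔇 (suc n) ℋ = 𝔇 n (λ C → D1 (λ i → ℋ (C ∷ʳ i)))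

  InM : ∀ {n} → Vec I n → Vec A n → Set
  InM []      []       = ⊤
  InM (i ∷ C) (a ∷ as) = a ∈ M i × InM C as

  record Relation (k : ℕ) : Set₁ where
    field
      ℋ       : Vec I k → Set
      ℋ-ne    : ∃[ C ] ℋ C
      R       : Vec I k → Vec A k → Set      -- R C is R_C (only relevant for C ∈ ℋ)
      R⊆M     : ∀ C → ℋ C → ∀ a → R C a → InM C a
      compat  : ∀ C C' → ℋ C → ℋ C' → ∀ a → InM C a → InM C' a →
                (R C a → R C' a) × (R C' a → R C a)

  IndefinitelyLargeRel : ∀ {k} → Relation k → Set
  IndefinitelyLargeRel {k} ρ = 𝔇 k (Relation.ℋ ρ)

  module _ {n : ℕ} (ρ : Relation (suc n)) where
    open Relation ρ

    Good : Vec I n → Vec A n → I → Set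
    Good C a i = ℋ (C ∷ʳ i) × ∃[ b ] (b ∈ M i × R (C ∷ʳ i) (a ∷ʳ b))

    IR : Vec I n → Vec A n → I → Set
    IR C a i = Good C a i ⊎ (¬ (∃[ j ] Good C a j))

    ≪top : Vec I (suc n) → Set
    ≪top E = ∃[ C ] ∃[ i ] (E ≡ C ∷ʳ i × (∀ a → InM C a → IR C a i))

  Prefix : ∀ {m p} → Vec I m → Vec I p → Set
  Prefix []      D       = ⊤
  Prefix (x ∷ C) []      = ⊥
  Prefix (x ∷ C) (y ∷ D) = x ≡ y × Prefix C D

  ≪R : ∀ {n} → Relation (suc n) → (m : ℕ) → Vec I m → Set
  ≪R {n} ρ m C =
      (m ≤ suc n × ∃[ E ] (≪top ρ E × Prefix C E))
    ⊎ (suc n < m × ∃[ E ] (≪top ρ E × Prefix E C))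

  RelSet : Set₁
  RelSet = List (Σ ℕ (λ n → Relation (suc n)))

  ≪S : RelSet → (m : ℕ) → Vec I m → Set₁
  ≪S S m C = All (λ p → ≪R (proj₂ p) m C) S

  Is≪Relation : ((m : ℕ) → Vec I m → Set₁) → Set₁
  Is≪Relation L = ∀ m (C : Vec I m) i → L (suc m) (C ∷ʳ i) → L m C

  IndefinitelyLarge≪ : ((m : ℕ) → Vec I m → Set₁) → Set₁
  IndefinitelyLarge≪ L = ∀ m → 𝔇 m (L m)

module Submission where

-- Each 𝔇 n behaves like a filter on I^n: it is upward closed, contains I^n and,
-- because ≼ is directed, is closed under binary hence finite intersections.
-- For an indefinitely large relation R and a context C whose fibre {i : Ci ∈ ℋ}
-- is in 𝔇₁, every I_{R,ā:C} is in 𝔇₁: if no i is good it is all of I, and if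
-- some j is good then compatibility transports the witness b to every i ≽ j
-- in the fibre.  Since M_C is finite, (≪_R)_{n+1} ∈ 𝔇_{n+1}; taking prefixes
-- and extensions preserves this, and so does the finite intersection over S.

open import Defs
open import Level using (0ℓ)
open import Axiom.ExcludedMiddle using (ExcludedMiddle)
open import Data.Product using (_×_; _,_; proj₁; proj₂; ∃-syntax)
open import Data.List using (List; []; _∷_)
open import Data.List.Membership.Propositional using (_∈_)
open import Data.List.Relation.Unary.All using (All; []; _∷_)
open import Data.List.Relation.Unary.Any using (here; there)
open import Data.Nat using (ℕ; suc; _≤_; _<_; s≤s; _≤?_)
open import Data.Nat using (_≤′_; ≤′-refl; ≤′-step; _≤‴_; ≤‴-refl; ≤‴-step)
open import Data.Nat.Properties using (≰⇒>; <⇒≤; ≤⇒≤′; ≤⇒≤‴)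
open import Data.Vec using (Vec; []; _∷_; _∷ʳ_)
open import Data.Sum using (_⊎_; inj₁; inj₂)
open import Data.Unit using (tt)
open import Relation.Nullary using (yes; no)
open import Relation.Binary.PropositionalEquality using (refl; sym)

module _ (Sys : System) where
  open System Sys

  private
    D1′ = D1 Sys
    𝔇′ = 𝔇 Sys

  D1-mono : ∀ {ℓ ℓ'} {P : I → Set ℓ} {Q : I → Set ℓ'} →
            (∀ i → P i → Q i) → D1′ P → D1′ Q
  D1-mono P⊆Q (i , cone) = i , λ i' i≼i' → P⊆Q i' (cone i' i≼i')

  D1-∩ : ∀ {ℓ ℓ'} {P : I → Set ℓ} {Q : I → Set ℓ'} →
         D1′ P → D1′ Q → D1′ (λ i → P i × Q i)
  D1-∩ (i , coneP) (j , coneQ) with directed i j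
  ... | k , i≼k , j≼k =
    k , λ i' k≼i' → coneP i' (≼-trans i≼k k≼i') , coneQ i' (≼-trans j≼k k≼i')

  D1-full : ∀ {ℓ} {P : I → Set ℓ} → (∀ i → P i) → D1′ P
  D1-full P-all = inhabited , λ i' _ → P-all i'

  D1-⋂-list : {B : Set} (L : List B) (Q : B → I → Set) →
              (∀ b → b ∈ L → D1′ (Q b)) → D1′ (λ i → ∀ b → b ∈ L → Q b i)
  D1-⋂-list []      Q large = D1-full (λ i b ())
  D1-⋂-list (x ∷ L) Q large =
    D1-mono (λ { i (Qx , QL) b (here refl) → Qx
               ; i (Qx , QL) b (there b∈L) → QL b b∈L })
            (D1-∩ (large x (here refl)) (D1-⋂-list L Q (λ b b∈L → large b (there b∈L))))

  D1-⋂-InM : ∀ {n} (C : Vec I n) (Q : Vec A n → I → Set) →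
             (∀ a → InM Sys C a → D1′ (Q a)) → D1′ (λ i → ∀ a → InM Sys C a → Q a i)
  D1-⋂-InM []      Q large = D1-mono (λ { i Q[] [] tt → Q[] }) (large [] tt)
  D1-⋂-InM (j ∷ C) Q large =
    D1-mono (λ { i Q∷ (a ∷ as) (a∈ , as∈) → Q∷ a a∈ as as∈ })
            (D1-⋂-list (M j) (λ a i → ∀ as → InM Sys C as → Q (a ∷ as) i)
               (λ a a∈ → D1-⋂-InM C (λ as → Q (a ∷ as))
                                   (λ as as∈ → large (a ∷ as) (a∈ , as∈))))

  𝔇-mono : ∀ {ℓ ℓ'} n {H : Vec I n → Set ℓ} {H' : Vec I n → Set ℓ'} →
           (∀ C → H C → H' C) → 𝔇′ n H → 𝔇′ n H'
  𝔇-mono 0       H⊆H' d = H⊆H' [] d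
  𝔇-mono (suc n) H⊆H' d = 𝔇-mono n (λ C → D1-mono (λ i → H⊆H' (C ∷ʳ i))) d

  𝔇-∩ : ∀ {ℓ ℓ'} n {H : Vec I n → Set ℓ} {H' : Vec I n → Set ℓ'} →
        𝔇′ n H → 𝔇′ n H' → 𝔇′ n (λ C → H C × H' C)
  𝔇-∩ 0       d d' = d , d'
  𝔇-∩ (suc n) d d' = 𝔇-mono n (λ C (e , e') → D1-∩ e e') (𝔇-∩ n d d')

  𝔇-full : ∀ {ℓ} n {H : Vec I n → Set ℓ} → (∀ C → H C) → 𝔇′ n H
  𝔇-full 0       H-all = H-all []
  𝔇-full (suc n) H-all = 𝔇-full n (λ C → D1-full (λ i → H-all (C ∷ʳ i)))

  InM-∷ʳ : ∀ {n} (C : Vec I n) (a : Vec A n) {i b} →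
           InM Sys C a → b ∈ M i → InM Sys (C ∷ʳ i) (a ∷ʳ b)
  InM-∷ʳ []      []      _           b∈ = b∈ , tt
  InM-∷ʳ (j ∷ C) (x ∷ a) (x∈ , a∈) b∈ = x∈ , InM-∷ʳ C a a∈ b∈

  module _ {n : ℕ} (ρ : Relation Sys (suc n)) where
    open Relation ρ

    Good-upward : ∀ {C a j i} → InM Sys C a → j ≼ i → ℋ (C ∷ʳ i) →
                  Good Sys ρ C a j → Good Sys ρ C a i
    Good-upward {C} {a} {j} {i} a∈ j≼i Ci∈ℋ (Cj∈ℋ , b , b∈Mj , Rab) =
      Ci∈ℋ , b , b∈Mi ,
      proj₁ (compat (C ∷ʳ j) (C ∷ʳ i) Cj∈ℋ Ci∈ℋ (a ∷ʳ b)
                    (R⊆M (C ∷ʳ j) Cj∈ℋ (a ∷ʳ b) Rab) (InM-∷ʳ C a a∈ b∈Mi)) Rab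
      where b∈Mi = mono j≼i b∈Mj

    IR-large : ExcludedMiddle 0ℓ → ∀ C → D1′ (λ i → ℋ (C ∷ʳ i)) →
               ∀ a → InM Sys C a → D1′ (IR Sys ρ C a)
    IR-large em C fibre a a∈ with em {∃[ j ] Good Sys ρ C a j}
    ... | no none          = D1-full (λ i → inj₂ none)
    ... | yes (j , good-j) =
      D1-mono (λ i (Ci∈ℋ , j≼i) → inj₁ (Good-upward a∈ j≼i Ci∈ℋ good-j))
              (D1-∩ fibre (j , λ i j≼i → j≼i))

    ≪top-large : ExcludedMiddle 0ℓ → IndefinitelyLargeRel Sys ρ → 𝔇′ (suc n) (≪top Sys ρ)
    ≪top-large em ℋ-large =
      𝔇-mono n (λ C fibre → D1-mono (λ i IR∋i → C , i , refl , IR∋i)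
                                     (D1-⋂-InM C (IR Sys ρ C) (IR-large em C fibre)))
               ℋ-large

  Prefix-refl : ∀ {m} (C : Vec I m) → Prefix Sys C C
  Prefix-refl []      = tt
  Prefix-refl (x ∷ C) = refl , Prefix-refl C

  Prefix-∷ʳ⁻ : ∀ {m p} (C : Vec I m) (E : Vec I p) {i} → Prefix Sys (C ∷ʳ i) E → Prefix Sys C E
  Prefix-∷ʳ⁻ []      E       _           = tt
  Prefix-∷ʳ⁻ (x ∷ C) (y ∷ E) (x≡y , pre) = x≡y , Prefix-∷ʳ⁻ C E pre

  Prefix-∷ʳ⁺ : ∀ {m p} (E : Vec I p) (C : Vec I m) {i} → Prefix Sys E C → Prefix Sys E (C ∷ʳ i)
  Prefix-∷ʳ⁺ []      C       _           = tt
  Prefix-∷ʳ⁺ (x ∷ E) (y ∷ C) (x≡y , pre) = x≡y , Prefix-∷ʳ⁺ E C pre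

  Prefix-of-∷ʳ⁻ : ∀ {m p} (E : Vec I p) (C : Vec I m) {i} → p ≤ m →
                  Prefix Sys E (C ∷ʳ i) → Prefix Sys E C
  Prefix-of-∷ʳ⁻ []      C       _         _           = tt
  Prefix-of-∷ʳ⁻ (x ∷ E) (y ∷ C) (s≤s p≤m) (x≡y , pre) = x≡y , Prefix-of-∷ʳ⁻ E C p≤m pre

  Prefix-sym : ∀ {m p} (E : Vec I p) (C : Vec I m) → m ≤ p → Prefix Sys E C → Prefix Sys C E
  Prefix-sym []      []      _         _           = tt
  Prefix-sym (x ∷ E) (y ∷ C) (s≤s m≤p) (x≡y , pre) = sym x≡y , Prefix-sym E C m≤p pre

  module _ {n : ℕ} (T : Vec I (suc n) → Set) where

    Prefixes Extensions : (m : ℕ) → Vec I m → Set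
    Prefixes   m C = ∃[ E ] (T E × Prefix Sys C E)
    Extensions m C = ∃[ E ] (T E × Prefix Sys E C)

    -- ≪R ρ is definitionally Generated (≪top Sys ρ).
    Generated : (m : ℕ) → Vec I m → Set
    Generated m C = (m ≤ suc n × Prefixes m C) ⊎ (suc n < m × Extensions m C)

    Generated-≪ : ∀ m (C : Vec I m) i → Generated (suc m) (C ∷ʳ i) → Generated m C
    Generated-≪ m C i (inj₁ (s≤s m≤n , E , T∋E , pre)) =
      inj₁ (<⇒≤ (s≤s m≤n) , E , T∋E , Prefix-∷ʳ⁻ C E pre)
    Generated-≪ m C i (inj₂ (s≤s n<m , E , T∋E , pre)) with m ≤? suc n
    ... | yes m≤1+n = inj₁ (m≤1+n , E , T∋E , Prefix-sym E C m≤1+n (Prefix-of-∷ʳ⁻ E C n<m pre))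
    ... | no  m≰1+n = inj₂ (≰⇒> m≰1+n , E , T∋E , Prefix-of-∷ʳ⁻ E C n<m pre)

    module _ (T-large : 𝔇′ (suc n) T) where

      Prefixes-large : ∀ {m} → m ≤‴ suc n → 𝔇′ m (Prefixes m)
      Prefixes-large ≤‴-refl =
        𝔇-mono (suc n) {H = T} {Prefixes (suc n)} (λ E T∋E → E , T∋E , Prefix-refl E) T-large
      Prefixes-large {m} (≤‴-step m<‴1+n) =
        𝔇-mono m (λ C (i , cone) → let (E , T∋E , pre) = cone i ≼-refl
                                   in E , T∋E , Prefix-∷ʳ⁻ C E pre)
                 (Prefixes-large m<‴1+n)

      Extensions-large : ∀ {m} → suc n ≤′ m → 𝔇′ m (Extensions m)
      Extensions-large ≤′-refl =
        𝔇-mono (suc n) {H = T} {Extensions (suc n)} (λ E T∋E → E , T∋E , Prefix-refl E) T-large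
      Extensions-large (≤′-step {m} n<m) =
        𝔇-mono m (λ C (E , T∋E , pre) → D1-full (λ i → E , T∋E , Prefix-∷ʳ⁺ E C pre))
                 (Extensions-large n<m)

      Generated-large : ∀ m → 𝔇′ m (Generated m)
      Generated-large m with m ≤? suc n
      ... | yes m≤1+n = 𝔇-mono m (λ C pre → inj₁ (m≤1+n , pre)) (Prefixes-large (≤⇒≤‴ m≤1+n))
      ... | no  m≰1+n = 𝔇-mono m (λ C ext → inj₂ (n<m , ext)) (Extensions-large (≤⇒≤′ (<⇒≤ n<m)))
        where n<m = ≰⇒> m≰1+n

  ≪S-≪ : (S : RelSet Sys) → Is≪Relation Sys (≪S Sys S)
  ≪S-≪ []            m C i []       = []
  ≪S-≪ ((n , ρ) ∷ S) m C i (r ∷ rs) = Generated-≪ (≪top Sys ρ) m C i r ∷ ≪S-≪ S m C i rs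

  ≪S-large : ExcludedMiddle 0ℓ → (S : RelSet Sys) →
             All (λ p → IndefinitelyLargeRel Sys (proj₂ p)) S → IndefinitelyLarge≪ Sys (≪S Sys S)
  ≪S-large em []            []       m = 𝔇-full m (λ C → [])
  ≪S-large em ((n , ρ) ∷ S) (d ∷ ds) m =
    𝔇-mono m (λ C (r , rs) → r ∷ rs)
             (𝔇-∩ m (Generated-large (≪top Sys ρ) (≪top-large ρ em d) m) (≪S-large em S ds m))

corollary4p7 : ExcludedMiddle 0ℓ → (Sys : System) → (S : RelSet Sys) →
    All (λ p → IndefinitelyLargeRel Sys (proj₂ p)) S →
    Is≪Relation Sys (≪S Sys S) × IndefinitelyLarge≪ Sys (≪S Sys S)
corollary4p7 em Sys S S-large = ≪S-≪ Sys S , ≪S-large Sys em S S-large
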